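{- Let $a,b$ be integers with $1\le a\le b$, and let $S(a,b)$ be the number of triples $(x_1,x_2,x_3)$ of integers with $x_1,x_2,x_3\in[a,b]$, $x_1\le x_2\le x_3$ and $x_1+x_2<x_3$. Then \[ S(a,b)=\sum_{i=a}^{\lfloor (b-1)/2\rfloor}\binom{b-2i+1}{2}. \] Equivalently, \[ S(a,b)= \begin{cases} 0,&b-2a\le 0,\\[1mm] \dfrac{u(u+1)(4u+5)}{6},&b-2a=2u\ge 2,\\[2mm] \dfrac{(u+1)(u+2)(4u+3)}{6},&b-2a=2u+1\ge 1. \end{cases} \]
   Context: For integers $a\le b$, $[a,b]=\{m\in\mathbb Z: a\le m\le b\}$. An empty sum is $0$. -}

module Defs where

open import Data.Nat using (ℕ; zero; suc; _+_; _*_; _∸_; _≤_; _<_; _≤?_; _<?_)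
open import Data.Nat.Combinatorics using (_C_)
open import Data.List using (List; []; _∷_; map; upTo; length; filter; concatMap)
open import Data.Nat.ListAction using (sum)
open import Data.Product using (_×_; _,_)
open import Relation.Nullary.Decidable using (_×-dec_)

-- The integer interval [a , c] = {m : a ≤ m ≤ c} as an increasing list
-- (empty when c < a).
interval : ℕ → ℕ → List ℕ
interval a c = map (a +_) (upTo (suc c ∸ a))

sumFromTo : ℕ → ℕ → (ℕ → ℕ) → ℕ
sumFromTo a c f = sum (map f (interval a c))

Triple : Set
Triple = ℕ × ℕ × ℕ

triplesIn : ℕ → ℕ → List Triple
triplesIn a b =
  concatMap (λ x₁ → concatMap (λ x₂ → map (λ x₃ → (x₁ , x₂ , x₃)) (interval a b))
                               (interval a b))
            (interval a b)

Good : Triple → Set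
Good (x₁ , x₂ , x₃) = (x₁ ≤ x₂) × (x₂ ≤ x₃) × (x₁ + x₂ < x₃)

good? : (t : Triple) → Relation.Nullary.Decidable.Dec (Good t)
good? (x₁ , x₂ , x₃) = (x₁ ≤? x₂) ×-dec ((x₂ ≤? x₃) ×-dec (x₁ + x₂ <? x₃))

S : ℕ → ℕ → ℕ
S a b = length (filter good? (triplesIn a b))

{-# OPTIONS --safe #-}
module Submission where

-- For x₁ ≤ x₂ the admissible x₃ are x₁ + x₂ + 1, …, b, so the pair (x₁ , x₂) contributes
-- b ∸ (x₁ + x₂); summing over x₂ ≥ x₁ gives the triangular number C(b + 1 ∸ 2x₁, 2), which
-- vanishes as soon as b ≤ 2x₁.  Writing b = 2a + c, the sum becomes Σᵢ C(c + 1 ∸ 2i, 2), and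
-- splitting off its first term lowers c by 2, which yields the closed forms by induction on u.

open import Defs
open import Data.Bool using (true; false)
open import Data.List using (List; []; _∷_; map; applyUpTo; length; filter; concatMap; _++_)
open import Data.List.Properties
  using (length-++; filter-++; filter-accept; filter-reject; filter-none; filter-≐; map-applyUpTo; map-cong)
open import Data.List.Relation.Unary.All using (universal)
open import Data.Nat using (ℕ; zero; suc; _+_; _*_; _∸_; _/_; _≤_; _<_; z≤n; s≤s; NonZero)
open import Data.Nat.Combinatorics using (_C_; nC1≡n; nCk+nC[k+1]≡[n+1]C[k+1]; k>n⇒nCk≡0)
open import Data.Nat.DivMod using (m*n/n≡m; m/n≤m; /-monoˡ-≤)
open import Data.Nat.ListAction using (sum)
open import Data.Nat.Properties
open import Data.Nat.Tactic.RingSolver using (solve; solve-∀)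
open import Data.Product using (_×_; _,_; proj₁; proj₂)
open import Data.Sum using (inj₁; inj₂)
open import Function using (_∘_; id)
open import Relation.Nullary using (¬_; does; yes; no; contradiction)
open import Relation.Unary using (Decidable)
open import Relation.Binary.PropositionalEquality
  using (_≡_; refl; sym; trans; cong; cong₂; subst; module ≡-Reasoning)

module _ {A B : Set} {P : B → Set} (P? : Decidable P) where

  length-filter-concatMap : (f : A → List B) (xs : List A) →
    length (filter P? (concatMap f xs)) ≡ sum (map (length ∘ filter P? ∘ f) xs)
  length-filter-concatMap f [] = refl
  length-filter-concatMap f (x ∷ xs) = begin
    length (filter P? (f x ++ concatMap f xs))
      ≡⟨ cong length (filter-++ P? (f x) (concatMap f xs)) ⟩
    length (filter P? (f x) ++ filter P? (concatMap f xs))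
      ≡⟨ length-++ (filter P? (f x)) ⟩
    length (filter P? (f x)) + length (filter P? (concatMap f xs))
      ≡⟨ cong (length (filter P? (f x)) +_) (length-filter-concatMap f xs) ⟩
    length (filter P? (f x)) + sum (map (length ∘ filter P? ∘ f) xs) ∎
    where open ≡-Reasoning

  length-filter-map : (f : A → B) (xs : List A) →
    length (filter P? (map f xs)) ≡ length (filter (λ x → P? (f x)) xs)
  length-filter-map f [] = refl
  length-filter-map f (x ∷ xs) with does (P? (f x))
  ... | true  = cong suc (length-filter-map f xs)
  ... | false = length-filter-map f xs

range : ℕ → ℕ → List ℕ
range a zero    = []
range a (suc n) = a ∷ range (suc a) n

applyUpTo-range : ∀ a n {f : ℕ → ℕ} → (∀ i → f i ≡ a + i) → applyUpTo f n ≡ range a n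
applyUpTo-range a zero    f≗ = refl
applyUpTo-range a (suc n) f≗ =
  cong₂ _∷_ (trans (f≗ 0) (+-identityʳ a))
            (applyUpTo-range (suc a) n (λ i → trans (f≗ (suc i)) (+-suc a i)))

interval≡range : ∀ a c → interval a c ≡ range a (suc c ∸ a)
interval≡range a c =
  trans (map-applyUpTo id (a +_) (suc c ∸ a)) (applyUpTo-range a (suc c ∸ a) (λ _ → refl))

length-filter-<-range : ∀ m a n → length (filter (m <?_) (range a n)) ≡ n ∸ (suc m ∸ a)
length-filter-<-range m a zero = sym (0∸n≡0 (suc m ∸ a))
length-filter-<-range m a (suc n) with m <? a
... | yes m<a = begin
  length (filter (m <?_) (a ∷ range (suc a) n))    ≡⟨ cong length (filter-accept (m <?_) m<a) ⟩
  suc (length (filter (m <?_) (range (suc a) n)))  ≡⟨ cong suc (length-filter-<-range m (suc a) n) ⟩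
  suc (n ∸ (m ∸ a))                                ≡⟨ cong (λ k → suc (n ∸ k)) (m≤n⇒m∸n≡0 (<⇒≤ m<a)) ⟩
  suc n                                            ≡⟨ cong (suc n ∸_) (m≤n⇒m∸n≡0 m<a) ⟨
  suc n ∸ (suc m ∸ a)                              ∎
  where open ≡-Reasoning
... | no m≮a = begin
  length (filter (m <?_) (a ∷ range (suc a) n))    ≡⟨ cong length (filter-reject (m <?_) m≮a) ⟩
  length (filter (m <?_) (range (suc a) n))        ≡⟨ length-filter-<-range m (suc a) n ⟩
  n ∸ (m ∸ a)                                      ≡⟨ cong (suc n ∸_) (+-∸-assoc 1 (≮⇒≥ m≮a)) ⟨
  suc n ∸ (suc m ∸ a)                              ∎
  where open ≡-Reasoning

sumFrom : ℕ → ℕ → (ℕ → ℕ) → ℕ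
sumFrom a n f = sum (map f (range a n))

sumFromTo≡sumFrom : ∀ a c f → sumFromTo a c f ≡ sumFrom a (suc c ∸ a) f
sumFromTo≡sumFrom a c f = cong (sum ∘ map f) (interval≡range a c)

sumFrom-cong : ∀ a n {f g : ℕ → ℕ} → (∀ i → a ≤ i → i < a + n → f i ≡ g i) →
  sumFrom a n f ≡ sumFrom a n g
sumFrom-cong a zero    f≗g = refl
sumFrom-cong a (suc n) f≗g =
  cong₂ _+_ (f≗g a ≤-refl (m<m+n a (s≤s z≤n)))
            (sumFrom-cong (suc a) n λ i a<i i<1+a+n →
               f≗g i (<⇒≤ a<i) (subst (i <_) (sym (+-suc a n)) i<1+a+n))

sumFrom-zero : ∀ a n {f : ℕ → ℕ} → (∀ i → a ≤ i → f i ≡ 0) → sumFrom a n f ≡ 0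
sumFrom-zero a zero    f≡0 = refl
sumFrom-zero a (suc n) f≡0 =
  cong₂ _+_ (f≡0 a ≤-refl) (sumFrom-zero (suc a) n (λ i a<i → f≡0 i (<⇒≤ a<i)))

sumFrom-shift : ∀ k a n (f : ℕ → ℕ) → sumFrom (k + a) n f ≡ sumFrom a n (λ i → f (k + i))
sumFrom-shift k a zero    f = refl
sumFrom-shift k a (suc n) f = cong (f (k + a) +_) (begin
  sumFrom (suc (k + a)) n f  ≡⟨ cong (λ j → sumFrom j n f) (+-suc k a) ⟨
  sumFrom (k + suc a) n f    ≡⟨ sumFrom-shift k (suc a) n f ⟩
  sumFrom (suc a) n (λ i → f (k + i)) ∎)
  where open ≡-Reasoning

sumFrom-dropInitialZeros : ∀ a n x {f : ℕ → ℕ} → a ≤ x → x ≤ a + n → (∀ i → i < x → f i ≡ 0) →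
  sumFrom a n f ≡ sumFrom x (a + n ∸ x) f
sumFrom-dropInitialZeros a n x {f} a≤x x≤a+n f≡0 with m≤n⇒m<n∨m≡n a≤x
... | inj₂ refl = cong (λ k → sumFrom a k f) (sym (m+n∸m≡n a n))
sumFrom-dropInitialZeros a zero    x a≤x x≤a+0 f≡0 | inj₁ a<x =
  contradiction (subst (_ ≤_) (+-identityʳ a) x≤a+0) (<⇒≱ a<x)
sumFrom-dropInitialZeros a (suc n) x {f} a≤x x≤a+1+n f≡0 | inj₁ a<x = begin
  f a + sumFrom (suc a) n f
    ≡⟨ cong₂ _+_ (f≡0 a a<x) (sumFrom-dropInitialZeros (suc a) n x a<x x≤1+a+n f≡0) ⟩
  sumFrom x (suc (a + n) ∸ x) f
    ≡⟨ cong (λ k → sumFrom x (k ∸ x) f) (+-suc a n) ⟨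
  sumFrom x (a + suc n ∸ x) f ∎
  where
  open ≡-Reasoning
  x≤1+a+n : x ≤ suc a + n
  x≤1+a+n = subst (x ≤_) (+-suc a n) x≤a+1+n

sumFrom-dropFinalZeros : ∀ a n q {f : ℕ → ℕ} → q < a + n → (∀ i → q < i → f i ≡ 0) →
  sumFrom a n f ≡ sumFrom a (suc q ∸ a) f
sumFrom-dropFinalZeros a n q {f} q<a+n f≡0 with a ≤? q
... | no a≰q = begin
  sumFrom a n f                ≡⟨ sumFrom-zero a n (λ i a≤i → f≡0 i (<-≤-trans (≰⇒> a≰q) a≤i)) ⟩
  0                            ≡⟨ cong (λ k → sumFrom a k f) (m≤n⇒m∸n≡0 (≰⇒> a≰q)) ⟨
  sumFrom a (suc q ∸ a) f      ∎
  where open ≡-Reasoning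
sumFrom-dropFinalZeros a zero    q q<a+0 f≡0 | yes a≤q =
  contradiction (subst (q <_) (+-identityʳ a) q<a+0) (≤⇒≯ a≤q)
sumFrom-dropFinalZeros a (suc n) q {f} q<a+1+n f≡0 | yes a≤q
  rewrite +-∸-assoc 1 a≤q =
  cong (f a +_) (sumFrom-dropFinalZeros (suc a) n q (subst (q <_) (+-suc a n) q<a+1+n) f≡0)

[1+n]C2≡n+nC2 : ∀ n → suc n C 2 ≡ n + n C 2
[1+n]C2≡n+nC2 n = trans (sym (nCk+nC[k+1]≡[n+1]C[k+1] n 1)) (cong (_+ n C 2) (nC1≡n n))

n≤1⇒nC2≡0 : ∀ {n} → n ≤ 1 → n C 2 ≡ 0
n≤1⇒nC2≡0 n≤1 = k>n⇒nCk≡0 (s≤s n≤1)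

2*[1+n]C2≡[1+n]*n : ∀ n → 2 * (suc n C 2) ≡ suc n * n
2*[1+n]C2≡[1+n]*n zero    = refl
2*[1+n]C2≡[1+n]*n (suc n) = begin
  2 * (suc (suc n) C 2)             ≡⟨ cong (2 *_) ([1+n]C2≡n+nC2 (suc n)) ⟩
  2 * (suc n + suc n C 2)           ≡⟨ *-distribˡ-+ 2 (suc n) (suc n C 2) ⟩
  2 * (1 + n) + 2 * (suc n C 2)     ≡⟨ cong (2 * (1 + n) +_) (2*[1+n]C2≡[1+n]*n n) ⟩
  2 * (1 + n) + (1 + n) * n         ≡⟨ solve (n ∷ []) ⟩
  (2 + n) * (1 + n)                 ∎
  where open ≡-Reasoning

[b∸a]+[b∸a]C2≡[1+b∸a]C2 : ∀ b a → (b ∸ a) + (b ∸ a) C 2 ≡ (suc b ∸ a) C 2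
[b∸a]+[b∸a]C2≡[1+b∸a]C2 b a with a ≤? b
... | yes a≤b = trans (sym ([1+n]C2≡n+nC2 (b ∸ a))) (cong (_C 2) (sym (+-∸-assoc 1 a≤b)))
... | no a≰b rewrite m≤n⇒m∸n≡0 (<⇒≤ (≰⇒> a≰b)) | m≤n⇒m∸n≡0 (≰⇒> a≰b) = refl

sumFrom-∸ : ∀ b a n → b ≤ a + n → sumFrom a n (b ∸_) ≡ (suc b ∸ a) C 2
sumFrom-∸ b a zero    b≤a+0 = sym (n≤1⇒nC2≡0 (m≤n+o⇒m∸n≤o (suc b) a 1+b≤a+1))
  where
  1+b≤a+1 : suc b ≤ a + 1
  1+b≤a+1 = subst (suc b ≤_) (trans (cong suc (+-identityʳ a)) (+-comm 1 a)) (s≤s b≤a+0)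
sumFrom-∸ b a (suc n) b≤a+1+n = begin
  (b ∸ a) + sumFrom (suc a) n (b ∸_)
    ≡⟨ cong ((b ∸ a) +_) (sumFrom-∸ b (suc a) n (subst (b ≤_) (+-suc a n) b≤a+1+n)) ⟩
  (b ∸ a) + (b ∸ a) C 2
    ≡⟨ [b∸a]+[b∸a]C2≡[1+b∸a]C2 b a ⟩
  (suc b ∸ a) C 2 ∎
  where open ≡-Reasoning

triangle : ℕ → ℕ → ℕ
triangle b x = (b + 1 ∸ 2 * x) C 2

triangle-vanishes : ∀ b x → b ≤ 2 * x → triangle b x ≡ 0
triangle-vanishes b x b≤2x = n≤1⇒nC2≡0 (m≤n+o⇒m∸n≤o (b + 1) (2 * x) (+-monoˡ-≤ 1 b≤2x))

[b∸1]/2<x⇒b≤2x : ∀ b x → (b ∸ 1) / 2 < x → b ≤ 2 * x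
[b∸1]/2<x⇒b≤2x b x q<x with b ≤? 2 * x
... | yes b≤2x = b≤2x
... | no b≰2x = contradiction x≤q (<⇒≱ q<x)
  where
  x≤q : x ≤ (b ∸ 1) / 2
  x≤q = subst (_≤ (b ∸ 1) / 2) (trans (cong (_/ 2) (*-comm 2 x)) (m*n/n≡m x 2))
              (/-monoˡ-≤ 2 (m+n≤o⇒m≤o∸n (2 * x) (subst (_≤ b) (+-comm 1 (2 * x)) (≰⇒> b≰2x))))

countGood : List ℕ → ℕ → ℕ → ℕ
countGood xs x₁ x₂ = length (filter good? (map (λ x₃ → (x₁ , x₂ , x₃)) xs))

S≡∑∑countGood : ∀ a b → let I = interval a b in
  S a b ≡ sum (map (λ x₁ → sum (map (countGood I x₁) I)) I)
S≡∑∑countGood a b =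
  trans (length-filter-concatMap good? _ I)
        (cong sum (map-cong (λ x₁ → length-filter-concatMap good? _ I) I))
  where I = interval a b

countGood-≰ : ∀ xs {x₁ x₂} → ¬ x₁ ≤ x₂ → countGood xs x₁ x₂ ≡ 0
countGood-≰ xs x₁≰x₂ =
  trans (length-filter-map good? _ xs)
        (cong length (filter-none _ (universal (λ _ → x₁≰x₂ ∘ proj₁) xs)))

countGood-≤ : ∀ xs {x₁ x₂} → x₁ ≤ x₂ → countGood xs x₁ x₂ ≡ length (filter (x₁ + x₂ <?_) xs)
countGood-≤ xs {x₁} {x₂} x₁≤x₂ =
  trans (length-filter-map good? _ xs)
        (cong length (filter-≐ _ (x₁ + x₂ <?_) (proj₂ ∘ proj₂ , good) xs))
  where
  good : ∀ {x₃} → x₁ + x₂ < x₃ → Good (x₁ , x₂ , x₃)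
  good x₁+x₂<x₃ = x₁≤x₂ , ≤-trans (m≤n+m x₂ x₁) (<⇒≤ x₁+x₂<x₃) , x₁+x₂<x₃

countGood-range : ∀ a b {x₁ x₂} → a ≤ x₁ → x₁ ≤ x₂ →
  countGood (range a (suc b ∸ a)) x₁ x₂ ≡ b ∸ (x₁ + x₂)
countGood-range a b {x₁} {x₂} a≤x₁ x₁≤x₂ = begin
  countGood R x₁ x₂                    ≡⟨ countGood-≤ R x₁≤x₂ ⟩
  length (filter (x₁ + x₂ <?_) R)      ≡⟨ length-filter-<-range (x₁ + x₂) a n ⟩
  n ∸ (suc (x₁ + x₂) ∸ a)              ≡⟨ ∸-+-assoc (suc b) a _ ⟩
  suc b ∸ (a + (suc (x₁ + x₂) ∸ a))    ≡⟨ cong (suc b ∸_) (m+[n∸m]≡n a≤1+x₁+x₂) ⟩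
  b ∸ (x₁ + x₂)                        ∎
  where
  open ≡-Reasoning
  n = suc b ∸ a
  R = range a n
  a≤1+x₁+x₂ : a ≤ suc (x₁ + x₂)
  a≤1+x₁+x₂ = ≤-trans a≤x₁ (≤-trans (m≤m+n x₁ x₂) (n≤1+n _))

∑countGood≡triangle : ∀ a b x → a ≤ x → x ≤ b →
  sumFrom a (suc b ∸ a) (countGood (range a (suc b ∸ a)) x) ≡ triangle b x
∑countGood≡triangle a b x a≤x x≤b = begin
  sumFrom a n (countGood R x)
    ≡⟨ sumFrom-dropInitialZeros a n x a≤x x≤a+n (λ _ y<x → countGood-≰ R (<⇒≱ y<x)) ⟩
  sumFrom x (a + n ∸ x) (countGood R x)
    ≡⟨ cong (λ e → sumFrom x (e ∸ x) (countGood R x)) a+n≡1+b ⟩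
  sumFrom x m (countGood R x)
    ≡⟨ sumFrom-cong x m (λ y x≤y _ → countGood-range a b a≤x x≤y) ⟩
  sumFrom x m (λ y → b ∸ (x + y))
    ≡⟨ sumFrom-shift x x m (b ∸_) ⟨
  sumFrom (x + x) m (b ∸_)
    ≡⟨ sumFrom-∸ b (x + x) m b≤2x+m ⟩
  (suc b ∸ (x + x)) C 2
    ≡⟨ cong₂ (λ s t → (s ∸ t) C 2) (+-comm 1 b) (cong (x +_) (sym (+-identityʳ x))) ⟩
  triangle b x ∎
  where
  open ≡-Reasoning
  n = suc b ∸ a
  m = suc b ∸ x
  R = range a n
  x≤1+b : x ≤ suc b
  x≤1+b = ≤-trans x≤b (n≤1+n b)
  a+n≡1+b : a + n ≡ suc b
  a+n≡1+b = m+[n∸m]≡n (≤-trans a≤x x≤1+b)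
  x+m≡1+b : x + m ≡ suc b
  x+m≡1+b = m+[n∸m]≡n x≤1+b
  x≤a+n : x ≤ a + n
  x≤a+n = subst (x ≤_) (sym a+n≡1+b) x≤1+b
  b≤2x+m : b ≤ x + x + m
  b≤2x+m = ≤-trans (n≤1+n b) (subst (_≤ x + x + m) x+m≡1+b (+-monoˡ-≤ m (m≤n+m x x)))

S≡sumFrom-triangle : ∀ a b → a ≤ b → S a b ≡ sumFrom a (suc b ∸ a) (triangle b)
S≡sumFrom-triangle a b a≤b = begin
  S a b
    ≡⟨ S≡∑∑countGood a b ⟩
  sum (map (λ x₁ → sum (map (countGood I x₁) I)) I)
    ≡⟨ cong (λ J → sum (map (λ x₁ → sum (map (countGood J x₁) J)) J)) (interval≡range a b) ⟩
  sumFrom a n (λ x₁ → sumFrom a n (countGood R x₁))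
    ≡⟨ sumFrom-cong a n (λ x a≤x x<a+n → ∑countGood≡triangle a b x a≤x (x≤b x<a+n)) ⟩
  sumFrom a n (triangle b) ∎
  where
  open ≡-Reasoning
  I = interval a b
  n = suc b ∸ a
  R = range a n
  x≤b : ∀ {x} → x < a + n → x ≤ b
  x≤b {x} x<a+n = ≤-pred (subst (x <_) (m+[n∸m]≡n (≤-trans a≤b (n≤1+n b))) x<a+n)

everyOtherC2Sum : ℕ → ℕ → ℕ
everyOtherC2Sum N m = sumFrom 0 N (λ i → (m ∸ 2 * i) C 2)

everyOtherC2Sum-step : ∀ N m → everyOtherC2Sum (suc N) (2 + m) ≡ (2 + m) C 2 + everyOtherC2Sum N m
everyOtherC2Sum-step N m = cong ((2 + m) C 2 +_) (begin
  sumFrom 1 N (λ i → (2 + m ∸ 2 * i) C 2)        ≡⟨ sumFrom-shift 1 0 N _ ⟩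
  sumFrom 0 N (λ i → (2 + m ∸ 2 * suc i) C 2)    ≡⟨ sumFrom-cong 0 N (λ i _ _ → cong (λ k → (2 + m ∸ k) C 2) (*-suc 2 i)) ⟩
  everyOtherC2Sum N m                            ∎)
  where open ≡-Reasoning

everyOtherC2Sum-≤1 : ∀ N {m} → m ≤ 1 → everyOtherC2Sum N m ≡ 0
everyOtherC2Sum-≤1 N {m} m≤1 =
  sumFrom-zero 0 N (λ i _ → n≤1⇒nC2≡0 (≤-trans (m∸n≤m m (2 * i)) m≤1))

6*[x+y]≡3*[2*x]+6*y : ∀ x y → 6 * (x + y) ≡ 3 * (2 * x) + 6 * y
6*[x+y]≡3*[2*x]+6*y = solve-∀

6*everyOtherC2Sum[2u+1] : ∀ u N → u ≤ N →
  6 * everyOtherC2Sum N (2 * u + 1) ≡ u * (u + 1) * (4 * u + 5)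
6*everyOtherC2Sum[2u+1] zero    N       _         = cong (6 *_) (everyOtherC2Sum-≤1 N ≤-refl)
6*everyOtherC2Sum[2u+1] (suc u) (suc N) (s≤s u≤N) = begin
  6 * everyOtherC2Sum (suc N) (2 * suc u + 1)
    ≡⟨ cong (λ k → 6 * everyOtherC2Sum (suc N) (k + 1)) (*-suc 2 u) ⟩
  6 * everyOtherC2Sum (suc N) (2 + w)
    ≡⟨ cong (6 *_) (everyOtherC2Sum-step N w) ⟩
  6 * ((2 + w) C 2 + everyOtherC2Sum N w)
    ≡⟨ 6*[x+y]≡3*[2*x]+6*y ((2 + w) C 2) (everyOtherC2Sum N w) ⟩
  3 * (2 * ((2 + w) C 2)) + 6 * everyOtherC2Sum N w
    ≡⟨ cong₂ (λ p q → 3 * p + q) (2*[1+n]C2≡[1+n]*n (1 + w)) (6*everyOtherC2Sum[2u+1] u N u≤N) ⟩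
  3 * ((2 + (2 * u + 1)) * (1 + (2 * u + 1))) + u * (u + 1) * (4 * u + 5)
    ≡⟨ solve (u ∷ []) ⟩
  (1 + u) * (1 + u + 1) * (4 * (1 + u) + 5) ∎
  where
  open ≡-Reasoning
  w = 2 * u + 1

6*everyOtherC2Sum[2u+2] : ∀ u N → u < N →
  6 * everyOtherC2Sum N (2 * u + 1 + 1) ≡ (u + 1) * (u + 2) * (4 * u + 3)
6*everyOtherC2Sum[2u+2] zero    (suc N) _         =
  cong (6 *_) (trans (everyOtherC2Sum-step N 0) (cong (1 +_) (everyOtherC2Sum-≤1 N z≤n)))
6*everyOtherC2Sum[2u+2] (suc u) (suc N) (s≤s u<N) = begin
  6 * everyOtherC2Sum (suc N) (2 * suc u + 1 + 1)
    ≡⟨ cong (λ k → 6 * everyOtherC2Sum (suc N) (k + 1 + 1)) (*-suc 2 u) ⟩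
  6 * everyOtherC2Sum (suc N) (2 + w)
    ≡⟨ cong (6 *_) (everyOtherC2Sum-step N w) ⟩
  6 * ((2 + w) C 2 + everyOtherC2Sum N w)
    ≡⟨ 6*[x+y]≡3*[2*x]+6*y ((2 + w) C 2) (everyOtherC2Sum N w) ⟩
  3 * (2 * ((2 + w) C 2)) + 6 * everyOtherC2Sum N w
    ≡⟨ cong₂ (λ p q → 3 * p + q) (2*[1+n]C2≡[1+n]*n (1 + w)) (6*everyOtherC2Sum[2u+2] u N u<N) ⟩
  3 * ((2 + (2 * u + 1 + 1)) * (1 + (2 * u + 1 + 1))) + (u + 1) * (u + 2) * (4 * u + 3)
    ≡⟨ solve (u ∷ []) ⟩
  (1 + u + 1) * (1 + u + 2) * (4 * (1 + u) + 3) ∎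
  where
  open ≡-Reasoning
  w = 2 * u + 1 + 1

S[a,2a+c]≡everyOtherC2Sum : ∀ a c → S a (2 * a + c) ≡ everyOtherC2Sum (suc (2 * a + c) ∸ a) (c + 1)
S[a,2a+c]≡everyOtherC2Sum a c = begin
  S a b
    ≡⟨ S≡sumFrom-triangle a b (≤-trans (m≤m+n a (a + 0)) (m≤m+n (2 * a) c)) ⟩
  sumFrom a N (triangle b)
    ≡⟨ cong (λ k → sumFrom k N (triangle b)) (+-identityʳ a) ⟨
  sumFrom (a + 0) N (triangle b)
    ≡⟨ sumFrom-shift a 0 N (triangle b) ⟩
  sumFrom 0 N (λ i → triangle b (a + i))
    ≡⟨ sumFrom-cong 0 N (λ i _ _ → cong (_C 2) (b+1∸2[a+i]≡c+1∸2i i)) ⟩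
  everyOtherC2Sum N (c + 1) ∎
  where
  open ≡-Reasoning
  b = 2 * a + c
  N = suc b ∸ a
  b+1∸2[a+i]≡c+1∸2i : ∀ i → b + 1 ∸ 2 * (a + i) ≡ c + 1 ∸ 2 * i
  b+1∸2[a+i]≡c+1∸2i i = begin
    2 * a + c + 1 ∸ 2 * (a + i)        ≡⟨ cong₂ _∸_ (+-assoc (2 * a) c 1) (*-distribˡ-+ 2 a i) ⟩
    2 * a + (c + 1) ∸ (2 * a + 2 * i)  ≡⟨ [m+n]∸[m+o]≡n∸o (2 * a) (c + 1) (2 * i) ⟩
    c + 1 ∸ 2 * i                      ∎

c<[1+2a+c]∸a : ∀ a c → c < suc (2 * a + c) ∸ a
c<[1+2a+c]∸a a c = begin-strict
  c                          <⟨ n<1+n c ⟩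
  suc c                      ≡⟨ m+n∸m≡n (2 * a) (suc c) ⟨
  2 * a + suc c ∸ 2 * a      ≡⟨ cong (_∸ 2 * a) (+-suc (2 * a) c) ⟩
  suc (2 * a + c) ∸ 2 * a    ≤⟨ ∸-monoʳ-≤ (suc (2 * a + c)) (m≤m+n a (a + 0)) ⟩
  suc (2 * a + c) ∸ a        ∎
  where open ≤-Reasoning

d*m≡n⇒m≡n/d : ∀ d {m n} .{{_ : NonZero d}} → d * m ≡ n → m ≡ n / d
d*m≡n⇒m≡n/d d {m} d*m≡n = trans (sym (m*n/n≡m m d)) (cong (_/ d) (trans (*-comm m d) d*m≡n))

S[a,2a+2u] : ∀ a u → S a (2 * a + 2 * u) ≡ (u * (u + 1) * (4 * u + 5)) / 6
S[a,2a+2u] a u = d*m≡n⇒m≡n/d 6 (trans (cong (6 *_) (S[a,2a+c]≡everyOtherC2Sum a (2 * u)))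
  (6*everyOtherC2Sum[2u+1] u _ (≤-trans (m≤m+n u (u + 0)) (<⇒≤ (c<[1+2a+c]∸a a (2 * u))))))

S[a,2a+2u+1] : ∀ a u → S a (2 * a + (2 * u + 1)) ≡ ((u + 1) * (u + 2) * (4 * u + 3)) / 6
S[a,2a+2u+1] a u = d*m≡n⇒m≡n/d 6 (trans (cong (6 *_) (S[a,2a+c]≡everyOtherC2Sum a (2 * u + 1)))
  (6*everyOtherC2Sum[2u+2] u _ (≤-trans (s≤s (≤-trans (m≤m+n u (u + 0)) (m≤m+n (2 * u) 1)))
                                         (c<[1+2a+c]∸a a (2 * u + 1)))))

S≡sumFromTo-triangle : ∀ a b → a ≤ b → S a b ≡ sumFromTo a ((b ∸ 1) / 2) (triangle b)
S≡sumFromTo-triangle a b a≤b = begin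
  S a b
    ≡⟨ S≡sumFrom-triangle a b a≤b ⟩
  sumFrom a n (triangle b)
    ≡⟨ sumFrom-dropFinalZeros a n q q<a+n (λ i q<i → triangle-vanishes b i ([b∸1]/2<x⇒b≤2x b i q<i)) ⟩
  sumFrom a (suc q ∸ a) (triangle b)
    ≡⟨ sumFromTo≡sumFrom a q (triangle b) ⟨
  sumFromTo a q (triangle b) ∎
  where
  open ≡-Reasoning
  n = suc b ∸ a
  q = (b ∸ 1) / 2
  q<a+n : q < a + n
  q<a+n = subst (q <_) (sym (m+[n∸m]≡n (≤-trans a≤b (n≤1+n b))))
                (s≤s (≤-trans (m/n≤m (b ∸ 1) 2) (m∸n≤m b 1)))

S≡0 : ∀ a b → a ≤ b → b ≤ 2 * a → S a b ≡ 0
S≡0 a b a≤b b≤2a = trans (S≡sumFrom-triangle a b a≤b)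
  (sumFrom-zero a (suc b ∸ a) (λ i a≤i → triangle-vanishes b i (≤-trans b≤2a (*-monoʳ-≤ 2 a≤i))))

proposition2p1 : (a b : ℕ) → 1 ≤ a → a ≤ b →
  (S a b ≡ sumFromTo a ((b ∸ 1) / 2) (λ i → (b + 1 ∸ 2 * i) C 2))
  × (b ≤ 2 * a → S a b ≡ 0)
  × ((u : ℕ) → 1 ≤ u → b ≡ 2 * a + 2 * u →
       S a b ≡ (u * (u + 1) * (4 * u + 5)) / 6)
  × ((u : ℕ) → b ≡ 2 * a + (2 * u + 1) →
       S a b ≡ ((u + 1) * (u + 2) * (4 * u + 3)) / 6)
proposition2p1 a b _ a≤b =
    S≡sumFromTo-triangle a b a≤b
  , S≡0 a b a≤b
  , (λ u _ b≡2a+2u → trans (cong (S a) b≡2a+2u) (S[a,2a+2u] a u))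
  , (λ u b≡2a+2u+1 → trans (cong (S a) b≡2a+2u+1) (S[a,2a+2u+1] a u))
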